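{- Let $h\geq 1$ and $1\leq d\leq h$. Let $L_h$ denote the polyomino of width $2$ whose left column consists of $h$ cells and whose right column consists of a single cell adjacent to the bottom cell of the left column. For $n\geq 0$ let \[ P_{d,n}(t)=\sum_{T} t^{\mathrm{bigtiles}(T)}, \] where $T$ ranges over all tilings of the board with $h+d-1$ rows and $n$ columns by unit squares and translates of $L_h$, and $\mathrm{bigtiles}(T)$ is the number of copies of $L_h$ used in $T$. Set $P_{d,m}(t)=0$ for $m<0$. Then $P_{d,0}(t)=1$ and for all $n\geq 0$, \[ P_{d,n+1}(t)=\sum_{k=0}^{d}\binom{d}{k}t^k\,P_{d,n-k}(t). \] In particular this recursion does not depend on $h$ as long as $h\geq d$. -}

module Defs where

open import Data.Nat using (ℕ; zero; suc; _+_; _*_; _∸_; _^_; _≤ᵇ_; _<ᵇ_; _≡ᵇ_)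
open import Data.Nat.Combinatorics using (_C_)
open import Data.Fin using (Fin; toℕ) renaming (zero to fzero; suc to fsuc)
open import Data.Bool using (Bool; true; false; _∧_; _∨_; if_then_else_)
open import Data.List using (List; []; _∷_; map; concatMap; allFin; upTo)
open import Data.Nat.ListAction using (sum)
open import Data.Bool.ListAction using () renaming (all to allL)

-- A tile is identified by its anchor = its bottom-left cell.
-- Board cell (x , y): x = row (0 = bottom row), y = column (0 = leftmost).
-- A tiling is described by saying, for every board cell, which tile
-- (if any) has that cell as its anchor.
data Anchor : Set where
  none  : Anchor
  unitT : Anchor
  bigT  : Anchor

allAnchors : List Anchor
allAnchors = none ∷ unitT ∷ bigT ∷ []

extend : {A : Set} {m : ℕ} → A → (Fin m → A) → Fin (suc m) → A
extend a g fzero    = a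
extend a g (fsuc i) = g i

allFuns : {A : Set} (m : ℕ) → List A → List (Fin m → A)
allFuns zero    xs = (λ ()) ∷ []
allFuns (suc m) xs = concatMap (λ a → map (extend a) (allFuns m xs)) xs

Board : ℕ → ℕ → Set
Board R n = Fin R → Fin n → Anchor

allBoards : (R n : ℕ) → List (Board R n)
allBoards R n = allFuns R (allFuns n allAnchors)

sumFin : (m : ℕ) → (Fin m → ℕ) → ℕ
sumFin m f = sum (map f (allFin m))

covers : (h : ℕ) → Anchor → (r c x y : ℕ) → Bool
covers h none  r c x y = false
covers h unitT r c x y = (x ≡ᵇ r) ∧ (y ≡ᵇ c)
covers h bigT  r c x y =
  ((y ≡ᵇ c) ∧ ((r ≤ᵇ x) ∧ (x <ᵇ r + h))) ∨ ((y ≡ᵇ suc c) ∧ (x ≡ᵇ r))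

fits : (h R n : ℕ) → Anchor → (r c : ℕ) → Bool
fits h R n none  r c = true
fits h R n unitT r c = true
fits h R n bigT  r c = (r + h ≤ᵇ R) ∧ (suc c <ᵇ n)

coverCount : (h R n : ℕ) → Board R n → (x y : ℕ) → ℕ
coverCount h R n T x y =
  sumFin R (λ r → sumFin n (λ c →
    if covers h (T r c) (toℕ r) (toℕ c) x y then 1 else 0))

isTiling : (h R n : ℕ) → Board R n → Bool
isTiling h R n T =
  allL (λ r → allL (λ c → fits h R n (T r c) (toℕ r) (toℕ c)) (allFin n)) (allFin R)
  ∧ allL (λ x → allL (λ y → coverCount h R n T (toℕ x) (toℕ y) ≡ᵇ 1) (allFin n)) (allFin R)

isBig : Anchor → ℕ
isBig bigT = 1
isBig _    = 0

bigtiles : (R n : ℕ) → Board R n → ℕ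
bigtiles R n T = sumFin R (λ r → sumFin n (λ c → isBig (T r c)))

P : (h d n t : ℕ) → ℕ
P h d n t =
  sum (map (λ T → if isTiling h (h + d ∸ 1) n T then t ^ bigtiles (h + d ∸ 1) n T else 0)
           (allBoards (h + d ∸ 1) n))

Pshift : (h d n k t : ℕ) → ℕ
Pshift h d n k t = if k ≤ᵇ n then P h d (n ∸ k) t else 0

recRHS : (h d n t : ℕ) → ℕ
recRHS h d n t = sum (map (λ k → (d C k) * (t ^ k) * Pshift h d n k t) (upTo (suc d)))

-- Weight each tiling by t ^ (number of copies of L_h) and build it column by column. The board
-- has h + d - 1 < 2h rows, so a column contains the long side of at most one copy, and two
-- consecutive columns interact only through the single cell that a copy anchored in row r of one
-- column occupies in row r of the next. Let V n s be the weighted count for n columns when row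
-- s - 1 of the first column is already covered (s = 0: no such row). A copy in the first column
-- must stay inside the board (r < d) and above the covered cell (s ≤ r), hence
--   V (n + 2) s = V (n + 1) 0 + t · Σ_{s ≤ r < d} V (n + 1) (r + 1).
-- Induction on n, using the hockey-stick identity Σ_{s ≤ r < d} C(d - 1 - r, k) = C(d - s, k + 1),
-- gives V (n + 1) s = Σ_k C(d - s, k) t^k P_{n-k}; the theorem is the case s = 0.

{-# OPTIONS --safe #-}
module Submission where

open import Defs
open import Algebra.Bundles using (CommutativeMonoid)
import Algebra.Properties.CommutativeSemigroup as CommutativeSemigroupProperties
open import Data.Bool using (Bool; true; false; _∧_; _∨_; if_then_else_)
open import Data.Bool.ListAction using (and) renaming (all to allL)
open import Data.Bool.Properties using (T-≡; ∧-commutativeMonoid; ∧-zeroʳ; ∧-identityʳ; ∨-identityʳ)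
open import Data.Fin using (Fin; toℕ) renaming (zero to fzero; suc to fsuc)
open import Data.List using (List; []; _∷_; _++_; map; concatMap; allFin; applyUpTo)
open import Data.List.Properties using (map-cong; map-++; map-∘; map-tabulate)
open import Data.Nat
  using (ℕ; zero; suc; pred; _+_; _*_; _∸_; _^_; _≤_; _<_; _≤ᵇ_; _<ᵇ_; _≡ᵇ_; z≤n; s≤s; z<s; s<s)
open import Data.Nat.Combinatorics using (_C_; k>n⇒nCk≡0; nCk+nC[k+1]≡[n+1]C[k+1])
open import Data.Nat.ListAction using (sum)
open import Data.Nat.ListAction.Properties using (sum-++)
open import Data.Nat.Properties
open import Data.Nat.Solver using (module +-*-Solver)
open import Data.Product using (_×_; _,_)
open import Function using (_∘_; id; Equivalence)
open import Relation.Binary.PropositionalEquality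
open import Relation.Nullary using (contradiction)

open CommutativeSemigroupProperties +-commutativeSemigroup using () renaming (interchange to +-interchange)
open CommutativeSemigroupProperties (CommutativeMonoid.commutativeSemigroup ∧-commutativeMonoid)
  using () renaming (interchange to ∧-interchange)

sumOver : {A : Set} → List A → (A → ℕ) → ℕ
sumOver xs f = sum (map f xs)

syntax sumOver xs (λ x → e) = ∑[ x ∈ xs ] e

module _ {A : Set} where

  sum-map-cong : (xs : List A) {f g : A → ℕ} → (∀ x → f x ≡ g x) → sum (map f xs) ≡ sum (map g xs)
  sum-map-cong xs f≗g = cong sum (map-cong f≗g xs)

  sum-map-zero : (xs : List A) {f : A → ℕ} → (∀ x → f x ≡ 0) → sum (map f xs) ≡ 0
  sum-map-zero []       f≗0 = refl
  sum-map-zero (x ∷ xs) f≗0 = cong₂ _+_ (f≗0 x) (sum-map-zero xs f≗0)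

  sum-map-+ : (xs : List A) (f g : A → ℕ) →
              sum (map (λ x → f x + g x) xs) ≡ sum (map f xs) + sum (map g xs)
  sum-map-+ []       f g = refl
  sum-map-+ (x ∷ xs) f g =
    trans (cong (f x + g x +_) (sum-map-+ xs f g)) (+-interchange (f x) (g x) _ _)

  sum-map-*ˡ : (xs : List A) (c : ℕ) (f : A → ℕ) → sum (map (λ x → c * f x) xs) ≡ c * sum (map f xs)
  sum-map-*ˡ []       c f = sym (*-zeroʳ c)
  sum-map-*ˡ (x ∷ xs) c f = trans (cong (c * f x +_) (sum-map-*ˡ xs c f)) (sym (*-distribˡ-+ c (f x) _))

  sum-map-concatMap : {B : Set} (g : B → List A) (f : A → ℕ) (ys : List B) →
                      sum (map f (concatMap g ys)) ≡ sum (map (λ y → sum (map f (g y))) ys)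
  sum-map-concatMap g f []       = refl
  sum-map-concatMap g f (y ∷ ys) = begin
    sum (map f (g y ++ concatMap g ys))              ≡⟨ cong sum (map-++ f (g y) _) ⟩
    sum (map f (g y) ++ map f (concatMap g ys))      ≡⟨ sum-++ (map f (g y)) _ ⟩
    sum (map f (g y)) + sum (map f (concatMap g ys)) ≡⟨ cong (_ +_) (sum-map-concatMap g f ys) ⟩
    sum (map f (g y)) + sum (map (λ y → sum (map f (g y))) ys) ∎
    where open ≡-Reasoning

  allL-cong : (xs : List A) {p q : A → Bool} → (∀ x → p x ≡ q x) → allL p xs ≡ allL q xs
  allL-cong xs p≗q = cong and (map-cong p≗q xs)

  allL-true : (xs : List A) {p : A → Bool} → (∀ x → p x ≡ true) → allL p xs ≡ true
  allL-true []       p≡true = refl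
  allL-true (x ∷ xs) p≡true = cong₂ _∧_ (p≡true x) (allL-true xs p≡true)

  allL-∧ : (xs : List A) (p q : A → Bool) → allL (λ x → p x ∧ q x) xs ≡ allL p xs ∧ allL q xs
  allL-∧ []       p q = refl
  allL-∧ (x ∷ xs) p q = trans (cong ((p x ∧ q x) ∧_) (allL-∧ xs p q)) (∧-interchange (p x) (q x) _ _)

sum-map-swap : {A B : Set} (xs : List A) (ys : List B) (f : A → B → ℕ) →
               sum (map (λ x → sum (map (f x) ys)) xs) ≡ sum (map (λ y → sum (map (λ x → f x y) xs)) ys)
sum-map-swap []       ys f = sym (sum-map-zero ys (λ _ → refl))
sum-map-swap (x ∷ xs) ys f =
  trans (cong (sum (map (f x) ys) +_) (sum-map-swap xs ys f)) (sym (sum-map-+ ys (f x) _))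

sumFin-suc : (m : ℕ) (f : Fin (suc m) → ℕ) → sumFin (suc m) f ≡ f fzero + sumFin m (f ∘ fsuc)
sumFin-suc m f = cong (f fzero +_) (cong sum (trans (map-tabulate fsuc f) (sym (map-tabulate id (f ∘ fsuc)))))

allL-allFin-suc : (m : ℕ) (p : Fin (suc m) → Bool) →
                  allL p (allFin (suc m)) ≡ p fzero ∧ allL (p ∘ fsuc) (allFin m)
allL-allFin-suc m p =
  cong (p fzero ∧_) (cong and (trans (map-tabulate fsuc p) (sym (map-tabulate id (p ∘ fsuc)))))

Σ< : ℕ → (ℕ → ℕ) → ℕ
Σ< zero    f = 0
Σ< (suc m) f = f 0 + Σ< m (f ∘ suc)

syntax Σ< m (λ i → e) = ∑[ i < m ] e

sum-applyUpTo : (m : ℕ) (g f : ℕ → ℕ) → sum (map f (applyUpTo g m)) ≡ Σ< m (f ∘ g)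
sum-applyUpTo zero    g f = refl
sum-applyUpTo (suc m) g f = cong (f (g 0) +_) (sum-applyUpTo m (g ∘ suc) f)

Σ<-cong : (m : ℕ) {f g : ℕ → ℕ} → (∀ i → i < m → f i ≡ g i) → Σ< m f ≡ Σ< m g
Σ<-cong zero    f≗g = refl
Σ<-cong (suc m) f≗g = cong₂ _+_ (f≗g 0 z<s) (Σ<-cong m (λ i i<m → f≗g (suc i) (s<s i<m)))

Σ<-zero : (m : ℕ) {f : ℕ → ℕ} → (∀ i → i < m → f i ≡ 0) → Σ< m f ≡ 0
Σ<-zero zero    f≗0 = refl
Σ<-zero (suc m) f≗0 = cong₂ _+_ (f≗0 0 z<s) (Σ<-zero m (λ i i<m → f≗0 (suc i) (s<s i<m)))

Σ<-+ : (m : ℕ) (f g : ℕ → ℕ) → Σ< m (λ i → f i + g i) ≡ Σ< m f + Σ< m g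
Σ<-+ zero    f g = refl
Σ<-+ (suc m) f g = trans (cong (f 0 + g 0 +_) (Σ<-+ m (f ∘ suc) (g ∘ suc))) (+-interchange (f 0) (g 0) _ _)

Σ<-*ˡ : (m c : ℕ) (f : ℕ → ℕ) → Σ< m (λ i → c * f i) ≡ c * Σ< m f
Σ<-*ˡ zero    c f = sym (*-zeroʳ c)
Σ<-*ˡ (suc m) c f = trans (cong (c * f 0 +_) (Σ<-*ˡ m c (f ∘ suc))) (sym (*-distribˡ-+ c (f 0) _))

Σ<-*ʳ : (m c : ℕ) (f : ℕ → ℕ) → Σ< m (λ i → f i * c) ≡ Σ< m f * c
Σ<-*ʳ m c f = trans (Σ<-cong m (λ i _ → *-comm (f i) c)) (trans (Σ<-*ˡ m c f) (*-comm c _))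

Σ<-swap : (m k : ℕ) (f : ℕ → ℕ → ℕ) → ∑[ i < m ] ∑[ j < k ] f i j ≡ ∑[ j < k ] ∑[ i < m ] f i j
Σ<-swap zero    k f = sym (Σ<-zero k (λ _ _ → refl))
Σ<-swap (suc m) k f = trans (cong (Σ< k (f 0) +_) (Σ<-swap m k (f ∘ suc))) (sym (Σ<-+ k (f 0) _))

Σ<-suc : (m : ℕ) (f : ℕ → ℕ) → Σ< (suc m) f ≡ Σ< m f + f m
Σ<-suc zero    f = +-identityʳ (f 0)
Σ<-suc (suc m) f = trans (cong (f 0 +_) (Σ<-suc m (f ∘ suc))) (sym (+-assoc (f 0) _ _))

Σ<-+-range : (a b : ℕ) (f : ℕ → ℕ) → Σ< (a + b) f ≡ Σ< a f + Σ< b (λ i → f (a + i))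
Σ<-+-range zero    b f = refl
Σ<-+-range (suc a) b f = trans (cong (f 0 +_) (Σ<-+-range a b (f ∘ suc))) (sym (+-assoc (f 0) _ _))

Σ<-truncate : ∀ {d R} (f : ℕ → ℕ) → d ≤ R → (∀ i → f (d + i) ≡ 0) → Σ< R f ≡ Σ< d f
Σ<-truncate {d} {R} f d≤R tail≡0 = begin
    Σ< R f                                 ≡⟨ cong (λ m → Σ< m f) (sym (m+[n∸m]≡n d≤R)) ⟩
    Σ< (d + (R ∸ d)) f                     ≡⟨ Σ<-+-range d (R ∸ d) f ⟩
    Σ< d f + Σ< (R ∸ d) (λ i → f (d + i))  ≡⟨ cong (Σ< d f +_) (Σ<-zero (R ∸ d) (λ i _ → tail≡0 i)) ⟩
    Σ< d f + 0                             ≡⟨ +-identityʳ _ ⟩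
    Σ< d f                                 ∎
  where open ≡-Reasoning

bit : Bool → ℕ
bit b = if b then 1 else 0

<ᵇ-suc : ∀ m n → (m <ᵇ suc n) ≡ (m ≤ᵇ n)
<ᵇ-suc zero    n = refl
<ᵇ-suc (suc m) n = refl

≤⇒≤ᵇ≡true : ∀ {m n} → m ≤ n → (m ≤ᵇ n) ≡ true
≤⇒≤ᵇ≡true m≤n = Equivalence.to T-≡ (≤⇒≤ᵇ m≤n)

≤ᵇ≡true⇒≤ : ∀ m n → (m ≤ᵇ n) ≡ true → m ≤ n
≤ᵇ≡true⇒≤ m n m≤ᵇn = ≤ᵇ⇒≤ m n (Equivalence.from T-≡ m≤ᵇn)

>⇒≤ᵇ≡false : ∀ {m n} → n < m → (m ≤ᵇ n) ≡ false
>⇒≤ᵇ≡false {m} {n} n<m with m ≤ᵇ n in m≤ᵇn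
... | true  = contradiction (≤ᵇ≡true⇒≤ m n m≤ᵇn) (<⇒≱ n<m)
... | false = refl

if-∧-false : ∀ (b : Bool) {x : ℕ} → (if b ∧ false then x else 0) ≡ 0
if-∧-false true  = refl
if-∧-false false = refl

if-cong-true : (b : Bool) {x y : ℕ} → (b ≡ true → x ≡ y) → (if b then x else 0) ≡ (if b then y else 0)
if-cong-true true  x≡y = x≡y refl
if-cong-true false x≡y = refl

if-then-0 : (b : Bool) → (if b then 0 else 0) ≡ 0
if-then-0 true  = refl
if-then-0 false = refl

if-then-*ˡ : (b : Bool) (c x : ℕ) → (if b then c * x else 0) ≡ c * (if b then x else 0)
if-then-*ˡ true  c x = refl
if-then-*ˡ false c x = sym (*-zeroʳ c)

if-then-Σ< : (b : Bool) (m : ℕ) (c X : ℕ → ℕ) →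
  (if b then ∑[ k < m ] (c k * X k) else 0) ≡ ∑[ k < m ] ((if b then c k else 0) * X k)
if-then-Σ< true  m c X = refl
if-then-Σ< false m c X = sym (Σ<-zero m (λ _ _ → refl))

pred-≤ᵇ : ∀ s r → (pred s ≤ᵇ r) ≡ (s ≤ᵇ suc r)
pred-≤ᵇ zero          r = refl
pred-≤ᵇ (suc zero)    r = refl
pred-≤ᵇ (suc (suc s)) r = refl

Σ<-hockeyStick : ∀ d s k → s ≤ d →
                 ∑[ r < d ] (if s ≤ᵇ r then (d ∸ suc r) C k else 0) ≡ (d ∸ s) C suc k
Σ<-hockeyStick zero    zero    k z≤n       = refl
Σ<-hockeyStick (suc d) zero    k _         =
  trans (cong (d C k +_) (Σ<-hockeyStick d zero k z≤n)) (nCk+nC[k+1]≡[n+1]C[k+1] d k)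
Σ<-hockeyStick (suc d) (suc s) k (s≤s s≤d) =
  trans (Σ<-cong d (λ r _ → cong (λ b → if b then (d ∸ suc r) C k else 0) (<ᵇ-suc s r)))
        (Σ<-hockeyStick d s k s≤d)

sum-allFuns-suc : {A : Set} (m : ℕ) (xs : List A) (F : (Fin (suc m) → A) → ℕ) →
                  ∑[ f ∈ allFuns (suc m) xs ] F f ≡ ∑[ x ∈ xs ] ∑[ f ∈ allFuns m xs ] F (extend x f)
sum-allFuns-suc m xs F =
  trans (sum-map-concatMap _ F xs) (sum-map-cong xs (λ x → cong sum (sym (map-∘ (allFuns m xs)))))

sum-allFuns-singleton : {A : Set} (m : ℕ) (x : A) (F : (Fin m → A) → ℕ) →
                        (∀ f → F f ≡ 1) → sum (map F (allFuns m (x ∷ []))) ≡ 1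
sum-allFuns-singleton zero    x F F≡1 = cong (_+ 0) (F≡1 _)
sum-allFuns-singleton (suc m) x F F≡1 =
  trans (sum-allFuns-suc m (x ∷ []) F)
        (cong (_+ 0) (sum-allFuns-singleton m x (F ∘ extend x) (F≡1 ∘ extend x)))

_≗₂_ : {A : Set} {R n : ℕ} → (Fin R → Fin n → A) → (Fin R → Fin n → A) → Set
T ≗₂ T' = ∀ r c → T r c ≡ T' r c

prependColumn : {A : Set} {R n : ℕ} → (Fin R → A) → (Fin R → Fin n → A) → Fin R → Fin (suc n) → A
prependColumn a g r = extend (a r) (g r)

sum-allFuns²-prependColumn :
  {A : Set} (R n : ℕ) (xs : List A) (F : (Fin R → Fin (suc n) → A) → ℕ) →
  (∀ T T' → T ≗₂ T' → F T ≡ F T') →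
  sum (map F (allFuns R (allFuns (suc n) xs))) ≡
  sum (map (λ a → sum (map (F ∘ prependColumn a) (allFuns R (allFuns n xs)))) (allFuns R xs))
sum-allFuns²-prependColumn zero    n xs F F-cong = cong (_+ 0) (trans (F-cong _ _ (λ ())) (sym (+-identityʳ _)))
sum-allFuns²-prependColumn (suc R) n xs F F-cong = begin
    sum (map F (allFuns (suc R) (allFuns (suc n) xs)))
  ≡⟨ sum-allFuns-suc R (allFuns (suc n) xs) F ⟩
    ∑[ row ∈ allFuns (suc n) xs ] ∑[ T ∈ allFuns R (allFuns (suc n) xs) ] F (extend row T)
  ≡⟨ sum-allFuns-suc n xs _ ⟩
    ∑[ x ∈ xs ] ∑[ row ∈ allFuns n xs ] ∑[ T ∈ allFuns R (allFuns (suc n) xs) ] F (extend (extend x row) T)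
  ≡⟨ sum-map-cong xs (λ x → sum-map-cong (allFuns n xs) (λ row →
       sum-allFuns²-prependColumn R n xs _ (λ T T' T≗T' → F-cong _ _ (λ { fzero c → refl ; (fsuc r) c → T≗T' r c })))) ⟩
    ∑[ x ∈ xs ] ∑[ row ∈ allFuns n xs ] ∑[ a ∈ allFuns R xs ] ∑[ g ∈ allFuns R (allFuns n xs) ]
      F (extend (extend x row) (prependColumn a g))
  ≡⟨ sum-map-cong xs (λ x → sum-map-swap (allFuns n xs) (allFuns R xs) _) ⟩
    ∑[ x ∈ xs ] ∑[ a ∈ allFuns R xs ] ∑[ row ∈ allFuns n xs ] ∑[ g ∈ allFuns R (allFuns n xs) ]
      F (extend (extend x row) (prependColumn a g))
  ≡⟨ sum-map-cong xs (λ x → sum-map-cong (allFuns R xs) (λ a → sym (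
       trans (sum-allFuns-suc R (allFuns n xs) _)
             (sum-map-cong (allFuns n xs) (λ row → sum-map-cong (allFuns R (allFuns n xs)) (λ g →
               F-cong _ _ (λ { fzero c → refl ; (fsuc r) c → refl }))))))) ⟩
    ∑[ x ∈ xs ] ∑[ a ∈ allFuns R xs ] ∑[ g ∈ allFuns (suc R) (allFuns n xs) ] F (prependColumn (extend x a) g)
  ≡⟨ sym (sum-allFuns-suc R xs _) ⟩
    ∑[ a ∈ allFuns (suc R) xs ] ∑[ g ∈ allFuns (suc R) (allFuns n xs) ] F (prependColumn a g)
  ∎
  where open ≡-Reasoning

-- pre x y counts how often cell (x , y) is already covered by tiles anchored outside the board.
Precover : Set
Precover = ℕ → ℕ → ℕ

module Tiling (h : ℕ) where

  completesTiling : (R n : ℕ) → Precover → Board R n → Bool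
  completesTiling R n pre T =
    allL (λ r → allL (λ c → fits h R n (T r c) (toℕ r) (toℕ c)) (allFin n)) (allFin R)
    ∧ allL (λ x → allL (λ y → (pre (toℕ x) (toℕ y) + coverCount h R n T (toℕ x) (toℕ y)) ≡ᵇ 1) (allFin n)) (allFin R)

  firstColumnCover : (R : ℕ) → (Fin R → Anchor) → ℕ → ℕ
  firstColumnCover R a x = sumFin R (λ r → bit (covers h (a r) (toℕ r) 0 x 0))

  admissibleColumn : (R n : ℕ) → (ℕ → ℕ) → (Fin R → Anchor) → Bool
  admissibleColumn R n e a =
    allL (λ r → fits h R (suc n) (a r) (toℕ r) 0) (allFin R)
    ∧ allL (λ x → (e (toℕ x) + firstColumnCover R a (toℕ x)) ≡ᵇ 1) (allFin R)

  precoverAfter : (R : ℕ) → Precover → (Fin R → Anchor) → Precover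
  precoverAfter R pre a x y = pre x (suc y) + sumFin R (λ r → bit (covers h (a r) (toℕ r) 0 x (suc y)))

  columnBigtiles : (R : ℕ) → (Fin R → Anchor) → ℕ
  columnBigtiles R a = sumFin R (λ r → isBig (a r))

  covers-suc-column : ∀ a r c x y → covers h a r (suc c) x (suc y) ≡ covers h a r c x y
  covers-suc-column none  r c x y = refl
  covers-suc-column unitT r c x y = refl
  covers-suc-column bigT  r c x y = refl

  covers-column-zero : ∀ a r c x → covers h a r (suc c) x 0 ≡ false
  covers-column-zero none  r c x = refl
  covers-column-zero unitT r c x = ∧-zeroʳ (x ≡ᵇ r)
  covers-column-zero bigT  r c x = refl

  fits-suc-column : ∀ R n a r c → fits h R (suc n) a r (suc c) ≡ fits h R n a r c
  fits-suc-column R n none  r c = refl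
  fits-suc-column R n unitT r c = refl
  fits-suc-column R n bigT  r c = refl

  coverCount-prependColumn-zero : (R n : ℕ) (a : Fin R → Anchor) (g : Board R n) (x : ℕ) →
    coverCount h R (suc n) (prependColumn a g) x 0 ≡ firstColumnCover R a x
  coverCount-prependColumn-zero R n a g x = sum-map-cong (allFin R) (λ r →
    trans (sumFin-suc n _)
      (trans (cong (bit (covers h (a r) (toℕ r) 0 x 0) +_)
                   (sum-map-zero (allFin n) (λ c → cong bit (covers-column-zero (g r c) (toℕ r) (toℕ c) x))))
             (+-identityʳ _)))

  coverCount-prependColumn-suc : (R n : ℕ) (a : Fin R → Anchor) (g : Board R n) (x y : ℕ) →
    coverCount h R (suc n) (prependColumn a g) x (suc y) ≡
      sumFin R (λ r → bit (covers h (a r) (toℕ r) 0 x (suc y))) + coverCount h R n g x y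
  coverCount-prependColumn-suc R n a g x y = trans (sum-map-cong (allFin R) (λ r →
    trans (sumFin-suc n _)
      (cong (bit (covers h (a r) (toℕ r) 0 x (suc y)) +_)
         (sum-map-cong (allFin n) (λ c → cong bit (covers-suc-column (g r c) (toℕ r) (toℕ c) x y))))))
    (sum-map-+ (allFin R) _ _)

  bigtiles-prependColumn : (R n : ℕ) (a : Fin R → Anchor) (g : Board R n) →
    bigtiles R (suc n) (prependColumn a g) ≡ columnBigtiles R a + bigtiles R n g
  bigtiles-prependColumn R n a g =
    trans (sum-map-cong (allFin R) (λ r → sumFin-suc n _)) (sum-map-+ (allFin R) _ _)

  completesTiling-prependColumn : (R n : ℕ) (pre : Precover) (a : Fin R → Anchor) (g : Board R n) →
    completesTiling R (suc n) pre (prependColumn a g)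
      ≡ admissibleColumn R n (λ x → pre x 0) a ∧ completesTiling R n (precoverAfter R pre a) g
  completesTiling-prependColumn R n pre a g =
    trans (cong₂ _∧_ fits-≡ covers-≡) (∧-interchange fitsFirst fitsRest coversFirst coversRest)
    where
    fitsFirst fitsRest coversFirst coversRest : Bool
    fitsFirst   = allL (λ r → fits h R (suc n) (a r) (toℕ r) 0) (allFin R)
    fitsRest    = allL (λ r → allL (λ c → fits h R n (g r c) (toℕ r) (toℕ c)) (allFin n)) (allFin R)
    coversFirst = allL (λ x → (pre (toℕ x) 0 + firstColumnCover R a (toℕ x)) ≡ᵇ 1) (allFin R)
    coversRest  = allL (λ x → allL (λ y → (precoverAfter R pre a (toℕ x) (toℕ y) + coverCount h R n g (toℕ x) (toℕ y)) ≡ᵇ 1)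
                                   (allFin n)) (allFin R)
    fits-≡ : allL (λ r → allL (λ c → fits h R (suc n) (prependColumn a g r c) (toℕ r) (toℕ c)) (allFin (suc n))) (allFin R)
           ≡ fitsFirst ∧ fitsRest
    fits-≡ = trans (allL-cong (allFin R) (λ r → trans (allL-allFin-suc n _)
                      (cong (fits h R (suc n) (a r) (toℕ r) 0 ∧_)
                        (allL-cong (allFin n) (λ c → fits-suc-column R n (g r c) (toℕ r) (toℕ c))))))
                   (allL-∧ (allFin R) _ _)
    covers-≡ : allL (λ x → allL (λ y → (pre (toℕ x) (toℕ y) + coverCount h R (suc n) (prependColumn a g) (toℕ x) (toℕ y)) ≡ᵇ 1)
                                 (allFin (suc n))) (allFin R)
             ≡ coversFirst ∧ coversRest
    covers-≡ = trans (allL-cong (allFin R) (λ x → trans (allL-allFin-suc n _)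
                        (cong₂ _∧_ (cong (λ k → (pre (toℕ x) 0 + k) ≡ᵇ 1) (coverCount-prependColumn-zero R n a g (toℕ x)))
                          (allL-cong (allFin n) (λ y → cong (_≡ᵇ 1)
                            (trans (cong (pre (toℕ x) (suc (toℕ y)) +_) (coverCount-prependColumn-suc R n a g (toℕ x) (toℕ y)))
                                   (sym (+-assoc (pre (toℕ x) (suc (toℕ y))) _ _))))))))
                     (allL-∧ (allFin R) _ _)

  module Weighted (t : ℕ) where

    weight : (R n : ℕ) → Precover → Board R n → ℕ
    weight R n pre T = if completesTiling R n pre T then t ^ bigtiles R n T else 0

    weightedCount : (R n : ℕ) → Precover → ℕ
    weightedCount R n pre = ∑[ T ∈ allBoards R n ] weight R n pre T

    weight-cong : (R n : ℕ) {pre pre' : Precover} {T T' : Board R n} →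
                  (∀ x y → pre x y ≡ pre' x y) → T ≗₂ T' → weight R n pre T ≡ weight R n pre' T'
    weight-cong R n {pre} {pre'} {T} {T'} pre≗pre' T≗T' =
      cong₂ (λ b k → if b then t ^ k else 0) completes-≡ bigtiles-≡
      where
      completes-≡ : completesTiling R n pre T ≡ completesTiling R n pre' T'
      completes-≡ = cong₂ _∧_
        (allL-cong (allFin R) (λ r → allL-cong (allFin n) (λ c → cong (λ a → fits h R n a (toℕ r) (toℕ c)) (T≗T' r c))))
        (allL-cong (allFin R) (λ x → allL-cong (allFin n) (λ y → cong (_≡ᵇ 1) (cong₂ _+_ (pre≗pre' (toℕ x) (toℕ y))
          (sum-map-cong (allFin R) (λ r → sum-map-cong (allFin n) (λ c →
            cong (λ a → bit (covers h a (toℕ r) (toℕ c) (toℕ x) (toℕ y))) (T≗T' r c))))))))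
      bigtiles-≡ : bigtiles R n T ≡ bigtiles R n T'
      bigtiles-≡ = sum-map-cong (allFin R) (λ r → sum-map-cong (allFin n) (λ c → cong isBig (T≗T' r c)))

    weightedCount-cong : (R n : ℕ) {pre pre' : Precover} → (∀ x y → pre x y ≡ pre' x y) →
                         weightedCount R n pre ≡ weightedCount R n pre'
    weightedCount-cong R n pre≗pre' =
      sum-map-cong (allBoards R n) (λ T → weight-cong R n pre≗pre' (λ _ _ → refl))

    weightedCount-zero : (R : ℕ) (pre : Precover) → weightedCount R 0 pre ≡ 1
    weightedCount-zero R pre = sum-allFuns-singleton R (λ ()) (weight R 0 pre) (λ T →
      cong₂ (λ b k → if b then t ^ k else 0)
        (cong₂ _∧_ (allL-true (allFin R) (λ _ → refl)) (allL-true (allFin R) (λ _ → refl)))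
        (sum-map-zero (allFin R) (λ _ → refl)))

    weightedCount-suc : (R n : ℕ) (pre : Precover) →
      weightedCount R (suc n) pre
        ≡ ∑[ a ∈ allFuns R allAnchors ]
            (if admissibleColumn R n (λ x → pre x 0) a
             then t ^ columnBigtiles R a * weightedCount R n (precoverAfter R pre a) else 0)
    weightedCount-suc R n pre =
      trans (sum-allFuns²-prependColumn R n allAnchors (weight R (suc n) pre)
                                         (λ _ _ → weight-cong R (suc n) {pre} (λ _ _ → refl)))
            (sum-map-cong (allFuns R allAnchors) sum-over-rest)
      where
      sum-over-rest : ∀ a → ∑[ g ∈ allBoards R n ] weight R (suc n) pre (prependColumn a g)
                          ≡ (if admissibleColumn R n (λ x → pre x 0) a
                             then t ^ columnBigtiles R a * weightedCount R n (precoverAfter R pre a) else 0)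
      sum-over-rest a with admissibleColumn R n (λ x → pre x 0) a in admissible
      ... | true  = trans (sum-map-cong (allBoards R n) weight-≡)
                          (sum-map-*ˡ (allBoards R n) (t ^ columnBigtiles R a) (weight R n (precoverAfter R pre a)))
        where
        weight-≡ : ∀ g → weight R (suc n) pre (prependColumn a g)
                       ≡ t ^ columnBigtiles R a * weight R n (precoverAfter R pre a) g
        weight-≡ g rewrite completesTiling-prependColumn R n pre a g | admissible | bigtiles-prependColumn R n a g
          with completesTiling R n (precoverAfter R pre a) g
        ... | true  = ^-distribˡ-+-* t (columnBigtiles R a) _
        ... | false = sym (*-zeroʳ (t ^ columnBigtiles R a))
      ... | false = sum-map-zero (allBoards R n) (λ g →
        cong (λ b → if b then t ^ bigtiles R (suc n) (prependColumn a g) else 0)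
             (trans (completesTiling-prependColumn R n pre a g)
                    (cong (_∧ completesTiling R n (precoverAfter R pre a) g) admissible)))

occupied : ℕ → ℕ → ℕ → ℕ
occupied k s x = bit (x <ᵇ k) + bit (suc x ≡ᵇ s)

occupied-suc : ∀ k s x → occupied k s (suc x) ≡ occupied (pred k) (pred s) x
occupied-suc zero    zero    x = refl
occupied-suc zero    (suc s) x = refl
occupied-suc (suc k) zero    x = refl
occupied-suc (suc k) (suc s) x = refl

-- The rest of the board sees the first column only through the rows of its big tiles.
profile : {m : ℕ} → (Fin m → Anchor) → Fin m → ℕ
profile a = isBig ∘ a

bigAt : {m : ℕ} → ℕ → Fin m → ℕ
bigAt r i = bit (toℕ i ≡ᵇ r)

Extensional : {m : ℕ} → ((Fin m → ℕ) → ℕ) → Set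
Extensional H = ∀ b b' → (∀ i → b i ≡ b' i) → H b ≡ H b'

Extensional-extend : {m : ℕ} {H : (Fin (suc m) → ℕ) → ℕ} →
                     Extensional H → ∀ c → Extensional (H ∘ extend c)
Extensional-extend H-ext c b b' b≗b' = H-ext _ _ λ { fzero → refl ; (fsuc i) → b≗b' i }

extend-profile : {m : ℕ} (H : (Fin (suc m) → ℕ) → ℕ) → Extensional H → ∀ a (as : Fin m → Anchor) →
                 H (profile (extend a as)) ≡ H (extend (isBig a) (profile as))
extend-profile H H-ext a as = H-ext _ _ λ { fzero → refl ; (fsuc i) → refl }

module FirstColumn (h' n : ℕ) where

  open Tiling (suc h')

  h : ℕ
  h = suc h'

  columnSum : (m : ℕ) → (ℕ → ℕ) → ((Fin m → Anchor) → ℕ) → ℕ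
  columnSum m e G = ∑[ a ∈ allFuns m allAnchors ] (if admissibleColumn m n e a then G a else 0)

  columnSum-cong : (m : ℕ) {e e' : ℕ → ℕ} {G G' : (Fin m → Anchor) → ℕ} →
                   (∀ x → e x ≡ e' x) → (∀ a → G a ≡ G' a) → columnSum m e G ≡ columnSum m e' G'
  columnSum-cong m e≗e' G≗G' = sum-map-cong (allFuns m allAnchors) (λ a →
    cong₂ (λ b g → if b then g else 0)
      (cong (_ ∧_) (allL-cong (allFin m) (λ x → cong (λ k → (k + firstColumnCover m a (toℕ x)) ≡ᵇ 1) (e≗e' (toℕ x)))))
      (G≗G' a))

  bottomAdmissible : (m : ℕ) → (ℕ → ℕ) → Anchor → Bool
  bottomAdmissible m e a = fits h (suc m) (suc n) a 0 0 ∧ ((e 0 + bit (covers h a 0 0 0 0)) ≡ᵇ 1)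

  precoverAbove : (ℕ → ℕ) → Anchor → ℕ → ℕ
  precoverAbove e a x = e (suc x) + bit (covers h a 0 0 (suc x) 0)

  fits-suc-row : ∀ m a r → fits h (suc m) (suc n) a (suc r) 0 ≡ fits h m (suc n) a r 0
  fits-suc-row m none  r = refl
  fits-suc-row m unitT r = refl
  fits-suc-row m bigT  r = cong (_∧ (1 <ᵇ suc n)) (<ᵇ-suc (r + h) m)

  covers-bottom-row : ∀ a r → covers h a (suc r) 0 0 0 ≡ false
  covers-bottom-row none  r = refl
  covers-bottom-row unitT r = refl
  covers-bottom-row bigT  r = refl

  covers-suc-row : ∀ a r x → covers h a (suc r) 0 (suc x) 0 ≡ covers h a r 0 x 0
  covers-suc-row none  r x = refl
  covers-suc-row unitT r x = refl
  covers-suc-row bigT  r x = cong (λ b → (b ∧ (x <ᵇ r + h)) ∨ false) (<ᵇ-suc r x)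

  admissibleColumn-extend : (m : ℕ) (e : ℕ → ℕ) (a : Anchor) (as : Fin m → Anchor) →
    admissibleColumn (suc m) n e (extend a as) ≡ bottomAdmissible m e a ∧ admissibleColumn m n (precoverAbove e a) as
  admissibleColumn-extend m e a as =
    trans (cong₂ _∧_ fits-≡ covers-≡)
          (∧-interchange (fits h (suc m) (suc n) a 0 0) fitsAbove coversBottom coversAbove)
    where
    fitsAbove coversBottom coversAbove : Bool
    fitsAbove    = allL (λ r → fits h m (suc n) (as r) (toℕ r) 0) (allFin m)
    coversBottom = (e 0 + bit (covers h a 0 0 0 0)) ≡ᵇ 1
    coversAbove  = allL (λ x → (precoverAbove e a (toℕ x) + firstColumnCover m as (toℕ x)) ≡ᵇ 1) (allFin m)
    fits-≡ : allL (λ r → fits h (suc m) (suc n) (extend a as r) (toℕ r) 0) (allFin (suc m))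
           ≡ fits h (suc m) (suc n) a 0 0 ∧ fitsAbove
    fits-≡ = trans (allL-allFin-suc m _)
               (cong (fits h (suc m) (suc n) a 0 0 ∧_) (allL-cong (allFin m) (λ r → fits-suc-row m (as r) (toℕ r))))
    cover-bottom : firstColumnCover (suc m) (extend a as) 0 ≡ bit (covers h a 0 0 0 0)
    cover-bottom = trans (sumFin-suc m _) (trans (cong (bit (covers h a 0 0 0 0) +_)
                     (sum-map-zero (allFin m) (λ r → cong bit (covers-bottom-row (as r) (toℕ r))))) (+-identityʳ _))
    cover-above : ∀ x → firstColumnCover (suc m) (extend a as) (suc x)
                        ≡ bit (covers h a 0 0 (suc x) 0) + firstColumnCover m as x
    cover-above x = trans (sumFin-suc m _) (cong (bit (covers h a 0 0 (suc x) 0) +_)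
                      (sum-map-cong (allFin m) (λ r → cong bit (covers-suc-row (as r) (toℕ r) x))))
    covers-≡ : allL (λ x → (e (toℕ x) + firstColumnCover (suc m) (extend a as) (toℕ x)) ≡ᵇ 1) (allFin (suc m))
             ≡ coversBottom ∧ coversAbove
    covers-≡ = trans (allL-allFin-suc m _) (cong₂ _∧_ (cong (λ k → (e 0 + k) ≡ᵇ 1) cover-bottom)
                 (allL-cong (allFin m) (λ x → cong (_≡ᵇ 1)
                   (trans (cong (e (suc (toℕ x)) +_) (cover-above (toℕ x))) (sym (+-assoc (e (suc (toℕ x))) _ _))))))

  columnSum-suc : (m : ℕ) (e : ℕ → ℕ) (G : (Fin (suc m) → Anchor) → ℕ) →
    columnSum (suc m) e G
      ≡ ∑[ a ∈ allAnchors ] (if bottomAdmissible m e a then columnSum m (precoverAbove e a) (G ∘ extend a) else 0)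
  columnSum-suc m e G = trans (sum-allFuns-suc m allAnchors _) (sum-map-cong allAnchors bottom)
    where
    bottom : ∀ a → ∑[ as ∈ allFuns m allAnchors ]
                       (if admissibleColumn (suc m) n e (extend a as) then G (extend a as) else 0)
                 ≡ (if bottomAdmissible m e a then columnSum m (precoverAbove e a) (G ∘ extend a) else 0)
    bottom a with bottomAdmissible m e a in admissible
    ... | true  = sum-map-cong (allFuns m allAnchors) (λ as → cong (λ b → if b then G (extend a as) else 0)
                    (trans (admissibleColumn-extend m e a as) (cong (_∧ admissibleColumn m n (precoverAbove e a) as) admissible)))
    ... | false = sum-map-zero (allFuns m allAnchors) (λ as → cong (λ b → if b then G (extend a as) else 0)
                    (trans (admissibleColumn-extend m e a as) (cong (_∧ admissibleColumn m n (precoverAbove e a) as) admissible)))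

  columnSum-suc-occupied : (m : ℕ) (e : ℕ → ℕ) (G : (Fin (suc m) → Anchor) → ℕ) → e 0 ≡ 1 →
    columnSum (suc m) e G ≡ columnSum m (e ∘ suc) (G ∘ extend none)
  columnSum-suc-occupied m e G e0≡1 rewrite columnSum-suc m e G | e0≡1 =
    trans (cong₂ _+_ (columnSum-cong m (λ x → +-identityʳ (e (suc x))) (λ _ → refl))
                     (cong (_+ 0) (if-∧-false (fits h (suc m) (suc n) bigT 0 0))))
          (+-identityʳ _)

  columnSum-suc-free : (m : ℕ) (e : ℕ → ℕ) (G : (Fin (suc m) → Anchor) → ℕ) → e 0 ≡ 0 →
    columnSum (suc m) e G
      ≡ columnSum m (e ∘ suc) (G ∘ extend unitT)
        + (if fits h (suc m) (suc n) bigT 0 0 then columnSum m (precoverAbove e bigT) (G ∘ extend bigT) else 0)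
  columnSum-suc-free m e G e0≡0 rewrite columnSum-suc m e G | e0≡0 =
    cong₂ _+_ (columnSum-cong m (λ x → +-identityʳ (e (suc x))) (λ _ → refl))
              (trans (+-identityʳ _)
                     (cong (λ b → if b then columnSum m (precoverAbove e bigT) (G ∘ extend bigT) else 0) (∧-identityʳ _)))

  columnSum-suc-clash : (m : ℕ) (e : ℕ → ℕ) (G : (Fin (suc m) → Anchor) → ℕ) → e 0 ≡ 2 →
    columnSum (suc m) e G ≡ 0
  columnSum-suc-clash m e G e0≡2 rewrite columnSum-suc m e G | e0≡2 =
    cong (_+ 0) (if-∧-false (fits h (suc m) (suc n) bigT 0 0))

  bigFits : ℕ → ℕ → Bool
  bigFits m r = fits h m (suc n) bigT r 0

  bigFits⇒≤ : ∀ m r → bigFits m r ≡ true → r + h ≤ m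
  bigFits⇒≤ m r fit with r + h ≤ᵇ m in r+h≤ᵇm
  ... | true = ≤ᵇ≡true⇒≤ (r + h) m r+h≤ᵇm

  columnSum-unitsOnly : ∀ m k (H : (Fin m → ℕ) → ℕ) → Extensional H → k ≤ m → m < k + h →
    columnSum m (occupied k 0) (H ∘ profile) ≡ H (λ _ → 0)
  columnSum-unitsOnly zero    zero    H H-ext _ _ = trans (+-identityʳ _) (H-ext _ _ (λ ()))
  columnSum-unitsOnly (suc m) zero    H H-ext _ m<h = begin
      columnSum (suc m) (occupied 0 0) (H ∘ profile)
    ≡⟨ columnSum-suc-free m (occupied 0 0) (H ∘ profile) refl ⟩
      columnSum m (occupied 0 0 ∘ suc) (H ∘ profile ∘ extend unitT)
        + (if bigFits (suc m) 0 then columnSum m (precoverAbove (occupied 0 0) bigT) (H ∘ profile ∘ extend bigT) else 0)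
    ≡⟨ cong₂ _+_ (columnSum-cong m (occupied-suc 0 0) (extend-profile H H-ext unitT))
                 (cong (λ b → if b ∧ (1 <ᵇ suc n) then columnSum m (precoverAbove (occupied 0 0) bigT) (H ∘ profile ∘ extend bigT) else 0)
                       (>⇒≤ᵇ≡false m<h)) ⟩
      columnSum m (occupied 0 0) ((H ∘ extend 0) ∘ profile) + 0
    ≡⟨ +-identityʳ _ ⟩
      columnSum m (occupied 0 0) ((H ∘ extend 0) ∘ profile)
    ≡⟨ columnSum-unitsOnly m 0 (H ∘ extend 0) (Extensional-extend H-ext 0) z≤n (<-trans (n<1+n m) m<h) ⟩
      H (extend 0 (λ _ → 0))
    ≡⟨ H-ext _ _ (λ { fzero → refl ; (fsuc i) → refl }) ⟩
      H (λ _ → 0)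
    ∎
    where open ≡-Reasoning
  columnSum-unitsOnly (suc m) (suc k) H H-ext (s≤s k≤m) m<k+h = begin
      columnSum (suc m) (occupied (suc k) 0) (H ∘ profile)
    ≡⟨ columnSum-suc-occupied m (occupied (suc k) 0) (H ∘ profile) refl ⟩
      columnSum m (occupied (suc k) 0 ∘ suc) (H ∘ profile ∘ extend none)
    ≡⟨ columnSum-cong m (occupied-suc (suc k) 0) (extend-profile H H-ext none) ⟩
      columnSum m (occupied k 0) ((H ∘ extend 0) ∘ profile)
    ≡⟨ columnSum-unitsOnly m k (H ∘ extend 0) (Extensional-extend H-ext 0) k≤m (≤-pred m<k+h) ⟩
      H (extend 0 (λ _ → 0))
    ≡⟨ H-ext _ _ (λ { fzero → refl ; (fsuc i) → refl }) ⟩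
      H (λ _ → 0)
    ∎
    where open ≡-Reasoning

  columnSum-clash : ∀ m k s (G : (Fin m → Anchor) → ℕ) → 0 < s → s ≤ k → s ≤ m →
                    columnSum m (occupied k s) G ≡ 0
  columnSum-clash (suc m) (suc k) (suc zero)    G _ _ _ = columnSum-suc-clash m (occupied (suc k) 1) G refl
  columnSum-clash (suc m) (suc k) (suc (suc s)) G _ (s≤s s<k) (s≤s s<m) =
    trans (columnSum-suc-occupied m (occupied (suc k) (suc (suc s))) G refl)
          (trans (columnSum-cong m (occupied-suc (suc k) (suc (suc s))) (λ _ → refl))
                 (columnSum-clash m k (suc s) (G ∘ extend none) z<s s<k s<m))

  precoverAbove-bigT : ∀ s x → precoverAbove (occupied 0 s) bigT x ≡ occupied h' (pred s) x
  precoverAbove-bigT s x =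
    trans (+-comm (occupied 0 s (suc x)) _) (cong₂ _+_ (cong bit (∨-identityʳ _)) (occupied-suc 0 s x))

  columnSum-bottom : ∀ m s (H : (Fin (suc m) → ℕ) → ℕ) → Extensional H → s ≤ h → suc m < h + h →
    columnSum (suc m) (occupied 0 s) (H ∘ profile)
      ≡ columnSum m (occupied 0 (pred s)) ((H ∘ extend 0) ∘ profile)
        + (if bigFits (suc m) 0 ∧ (s ≤ᵇ 0) then H (bigAt 0) else 0)
  columnSum-bottom m zero H H-ext _ m<2h = begin
      columnSum (suc m) (occupied 0 0) (H ∘ profile)
    ≡⟨ columnSum-suc-free m (occupied 0 0) (H ∘ profile) refl ⟩
      columnSum m (occupied 0 0 ∘ suc) (H ∘ profile ∘ extend unitT)
        + (if bigFits (suc m) 0 then columnSum m (precoverAbove (occupied 0 0) bigT) (H ∘ profile ∘ extend bigT) else 0)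
    ≡⟨ cong₂ _+_ (columnSum-cong m (occupied-suc 0 0) (extend-profile H H-ext unitT))
                 (trans (if-cong-true (bigFits (suc m) 0) bigTile)
                        (cong (λ b → if b then H (bigAt 0) else 0) (sym (∧-identityʳ _)))) ⟩
      columnSum m (occupied 0 0) ((H ∘ extend 0) ∘ profile) + (if bigFits (suc m) 0 ∧ true then H (bigAt 0) else 0)
    ∎
    where
    open ≡-Reasoning
    bigTile : bigFits (suc m) 0 ≡ true →
              columnSum m (precoverAbove (occupied 0 0) bigT) (H ∘ profile ∘ extend bigT) ≡ H (bigAt 0)
    bigTile fit = begin
        columnSum m (precoverAbove (occupied 0 0) bigT) (H ∘ profile ∘ extend bigT)
      ≡⟨ columnSum-cong m (precoverAbove-bigT 0) (extend-profile H H-ext bigT) ⟩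
        columnSum m (occupied h' 0) ((H ∘ extend 1) ∘ profile)
      ≡⟨ columnSum-unitsOnly m h' (H ∘ extend 1) (Extensional-extend H-ext 1)
           (≤-pred (bigFits⇒≤ (suc m) 0 fit)) (≤-pred m<2h) ⟩
        H (extend 1 (λ _ → 0))
      ≡⟨ H-ext _ _ (λ { fzero → refl ; (fsuc i) → refl }) ⟩
        H (bigAt 0)
      ∎
  columnSum-bottom m (suc zero) H H-ext _ _ = begin
      columnSum (suc m) (occupied 0 1) (H ∘ profile)
    ≡⟨ columnSum-suc-occupied m (occupied 0 1) (H ∘ profile) refl ⟩
      columnSum m (occupied 0 1 ∘ suc) (H ∘ profile ∘ extend none)
    ≡⟨ columnSum-cong m (occupied-suc 0 1) (extend-profile H H-ext none) ⟩
      columnSum m (occupied 0 0) ((H ∘ extend 0) ∘ profile)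
    ≡⟨ sym (trans (cong (columnSum m (occupied 0 0) ((H ∘ extend 0) ∘ profile) +_) (if-∧-false (bigFits (suc m) 0)))
                  (+-identityʳ _)) ⟩
      columnSum m (occupied 0 0) ((H ∘ extend 0) ∘ profile) + (if bigFits (suc m) 0 ∧ false then H (bigAt 0) else 0)
    ∎
    where open ≡-Reasoning
  columnSum-bottom m (suc (suc s)) H H-ext s≤h _ = begin
      columnSum (suc m) (occupied 0 (2 + s)) (H ∘ profile)
    ≡⟨ columnSum-suc-free m (occupied 0 (2 + s)) (H ∘ profile) refl ⟩
      columnSum m (occupied 0 (2 + s) ∘ suc) (H ∘ profile ∘ extend unitT)
        + (if bigFits (suc m) 0 then columnSum m (precoverAbove (occupied 0 (2 + s)) bigT) (H ∘ profile ∘ extend bigT) else 0)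
    ≡⟨ cong₂ _+_ (columnSum-cong m (occupied-suc 0 (2 + s)) (extend-profile H H-ext unitT))
                 (trans (if-cong-true (bigFits (suc m) 0) bigTile)
                        (trans (if-then-0 (bigFits (suc m) 0)) (sym (if-∧-false (bigFits (suc m) 0))))) ⟩
      columnSum m (occupied 0 (suc s)) ((H ∘ extend 0) ∘ profile) + (if bigFits (suc m) 0 ∧ false then H (bigAt 0) else 0)
    ∎
    where
    open ≡-Reasoning
    bigTile : bigFits (suc m) 0 ≡ true →
              columnSum m (precoverAbove (occupied 0 (2 + s)) bigT) (H ∘ profile ∘ extend bigT) ≡ 0
    bigTile fit = trans (columnSum-cong m (precoverAbove-bigT (2 + s)) (λ _ → refl))
                        (columnSum-clash m h' (suc s) _ z<s (≤-pred s≤h)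
                                         (≤-trans (≤-pred s≤h) (≤-pred (bigFits⇒≤ (suc m) 0 fit))))

  -- Since s ≤ h, a copy anchored in row r misses row s - 1 exactly when s ≤ r.
  columnSum-split : ∀ m s (H : (Fin m → ℕ) → ℕ) → Extensional H → s ≤ h → m < h + h →
    columnSum m (occupied 0 s) (H ∘ profile)
      ≡ H (λ _ → 0) + ∑[ r < m ] (if bigFits m r ∧ (s ≤ᵇ r) then H (bigAt r) else 0)
  columnSum-split zero    s H H-ext _ _ = cong (_+ 0) (H-ext _ _ (λ ()))
  columnSum-split (suc m) s H H-ext s≤h m<2h = begin
      columnSum (suc m) (occupied 0 s) (H ∘ profile)
    ≡⟨ columnSum-bottom m s H H-ext s≤h m<2h ⟩
      columnSum m (occupied 0 (pred s)) ((H ∘ extend 0) ∘ profile) + bigAtBottom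
    ≡⟨ cong (_+ bigAtBottom) (columnSum-split m (pred s) (H ∘ extend 0) (Extensional-extend H-ext 0)
                                (≤-trans pred[n]≤n s≤h) (<-trans (n<1+n m) m<2h)) ⟩
      H (extend 0 (λ _ → 0)) + ∑[ r < m ] (if bigFits m r ∧ (pred s ≤ᵇ r) then H (extend 0 (bigAt r)) else 0) + bigAtBottom
    ≡⟨ cong₂ (λ u v → u + v + bigAtBottom) (H-ext _ _ (λ { fzero → refl ; (fsuc i) → refl }))
                                            (Σ<-cong m (λ r _ → shift r)) ⟩
      H (λ _ → 0) + bigAbove + bigAtBottom
    ≡⟨ trans (+-assoc (H (λ _ → 0)) bigAbove bigAtBottom) (cong (H (λ _ → 0) +_) (+-comm bigAbove bigAtBottom)) ⟩
      H (λ _ → 0) + (bigAtBottom + bigAbove)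
    ∎
    where
    open ≡-Reasoning
    bigAtBottom bigAbove : ℕ
    bigAtBottom = if bigFits (suc m) 0 ∧ (s ≤ᵇ 0) then H (bigAt 0) else 0
    bigAbove    = ∑[ r < m ] (if bigFits (suc m) (suc r) ∧ (s ≤ᵇ suc r) then H (bigAt (suc r)) else 0)
    shift : ∀ r → (if bigFits m r ∧ (pred s ≤ᵇ r) then H (extend 0 (bigAt r)) else 0)
                ≡ (if bigFits (suc m) (suc r) ∧ (s ≤ᵇ suc r) then H (bigAt (suc r)) else 0)
    shift r = cong₂ (λ b v → if b then v else 0)
                (cong₂ _∧_ (sym (fits-suc-row m bigT r)) (pred-≤ᵇ s r))
                (H-ext _ _ (λ { fzero → refl ; (fsuc i) → refl }))

-- Row s - 1 (none if s = 0) of the first column is covered by a copy of L_h from the previous column.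
protrusion : ℕ → Precover
protrusion s x zero    = bit (suc x ≡ᵇ s)
protrusion s x (suc y) = 0

sumFin-bigAt : (R r : ℕ) (f : ℕ → ℕ) → r < R → sumFin R (λ i → bigAt r i * f (toℕ i)) ≡ f r
sumFin-bigAt (suc R) zero    f _ =
  trans (sumFin-suc R (λ i → bigAt 0 i * f (toℕ i)))
        (trans (cong₂ _+_ (+-identityʳ (f 0)) (sum-map-zero (allFin R) (λ _ → refl))) (+-identityʳ _))
sumFin-bigAt (suc R) (suc r) f (s≤s r<R) =
  trans (sumFin-suc R (λ i → bigAt (suc r) i * f (toℕ i))) (sumFin-bigAt R r (f ∘ suc) r<R)

module Transfer (h' t n : ℕ) where

  open Tiling (suc h')
  open Weighted t
  open FirstColumn h' n

  covers-nextColumn : ∀ a r x y → bit (covers h a r 0 x (suc y)) ≡ isBig a * bit ((y ≡ᵇ 0) ∧ (x ≡ᵇ r))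
  covers-nextColumn none  r x y = refl
  covers-nextColumn unitT r x y = cong bit (∧-zeroʳ (x ≡ᵇ r))
  covers-nextColumn bigT  r x y = sym (+-identityʳ _)

  nextPrecover : (R : ℕ) → (Fin R → ℕ) → Precover
  nextPrecover R b x y = sumFin R (λ r → b r * bit ((y ≡ᵇ 0) ∧ (x ≡ᵇ toℕ r)))

  profileWeight : (R : ℕ) → (Fin R → ℕ) → ℕ
  profileWeight R b = t ^ sumFin R b * weightedCount R n (nextPrecover R b)

  profileWeight-ext : (R : ℕ) → Extensional (profileWeight R)
  profileWeight-ext R b b' b≗b' = cong₂ (λ k w → t ^ k * w) (sum-map-cong (allFin R) b≗b')
    (weightedCount-cong R n (λ x y → sum-map-cong (allFin R) (λ r → cong (_* bit ((y ≡ᵇ 0) ∧ (x ≡ᵇ toℕ r))) (b≗b' r))))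

  columnWeight-profile : (R s : ℕ) (a : Fin R → Anchor) →
    t ^ columnBigtiles R a * weightedCount R n (precoverAfter R (protrusion s) a) ≡ profileWeight R (profile a)
  columnWeight-profile R s a = cong (t ^ columnBigtiles R a *_)
    (weightedCount-cong R n (λ x y → sum-map-cong (allFin R) (λ r → covers-nextColumn (a r) (toℕ r) x y)))

  profileWeight-noBig : (R : ℕ) → profileWeight R (λ _ → 0) ≡ weightedCount R n (protrusion 0)
  profileWeight-noBig R =
    trans (cong₂ (λ k w → t ^ k * w) (sum-map-zero (allFin R) (λ _ → refl)) (weightedCount-cong R n noProtrusion))
          (+-identityʳ _)
    where
    noProtrusion : ∀ x y → nextPrecover R (λ _ → 0) x y ≡ protrusion 0 x y
    noProtrusion x zero    = sum-map-zero (allFin R) (λ _ → refl)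
    noProtrusion x (suc y) = sum-map-zero (allFin R) (λ _ → refl)

  profileWeight-bigAt : (R r : ℕ) → r < R → profileWeight R (bigAt r) ≡ t * weightedCount R n (protrusion (suc r))
  profileWeight-bigAt R r r<R =
    cong₂ _*_ (trans (cong (t ^_) oneBig) (^-identityʳ t)) (weightedCount-cong R n protrusion-r)
    where
    oneBig : sumFin R (bigAt r) ≡ 1
    oneBig = trans (sum-map-cong (allFin R) (λ i → sym (*-identityʳ (bigAt r i)))) (sumFin-bigAt R r (λ _ → 1) r<R)
    protrusion-r : ∀ x y → nextPrecover R (bigAt r) x y ≡ protrusion (suc r) x y
    protrusion-r x zero    = sumFin-bigAt R r (λ i → bit (x ≡ᵇ i)) r<R
    protrusion-r x (suc y) = sum-map-zero (allFin R) (λ i → *-zeroʳ (bigAt r i))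

  weightedCount-transfer : (R s : ℕ) → R < h + h → s ≤ h →
    weightedCount R (suc n) (protrusion s)
      ≡ weightedCount R n (protrusion 0)
        + ∑[ r < R ] (if bigFits R r ∧ (s ≤ᵇ r) then t * weightedCount R n (protrusion (suc r)) else 0)
  weightedCount-transfer R s R<2h s≤h = begin
      weightedCount R (suc n) (protrusion s)
    ≡⟨ weightedCount-suc R n (protrusion s) ⟩
      columnSum R (occupied 0 s) (λ a → t ^ columnBigtiles R a * weightedCount R n (precoverAfter R (protrusion s) a))
    ≡⟨ columnSum-cong R {occupied 0 s} (λ _ → refl) (columnWeight-profile R s) ⟩
      columnSum R (occupied 0 s) (profileWeight R ∘ profile)
    ≡⟨ columnSum-split R s (profileWeight R) (profileWeight-ext R) s≤h R<2h ⟩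
      profileWeight R (λ _ → 0) + ∑[ r < R ] (if bigFits R r ∧ (s ≤ᵇ r) then profileWeight R (bigAt r) else 0)
    ≡⟨ cong₂ _+_ (profileWeight-noBig R) (Σ<-cong R (λ r r<R →
         cong (λ w → if bigFits R r ∧ (s ≤ᵇ r) then w else 0) (profileWeight-bigAt R r r<R))) ⟩
      weightedCount R n (protrusion 0)
        + ∑[ r < R ] (if bigFits R r ∧ (s ≤ᵇ r) then t * weightedCount R n (protrusion (suc r)) else 0)
    ∎
    where open ≡-Reasoning

module TransferRecurrence (t d : ℕ) (V : ℕ → ℕ → ℕ)
  (V-one  : ∀ s → s ≤ d → V 1 s ≡ V 0 0)
  (V-step : ∀ n s → s ≤ d →
            V (2 + n) s ≡ V (1 + n) 0 + t * ∑[ r < d ] (if s ≤ᵇ r then V (1 + n) (suc r) else 0))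
  where

  Vshift : ℕ → ℕ → ℕ
  Vshift n k = if k ≤ᵇ n then V (n ∸ k) 0 else 0

  Vshift-suc : ∀ n k → Vshift (suc n) (suc k) ≡ Vshift n k
  Vshift-suc n k = cong (λ b → if b then V (n ∸ k) 0 else 0) (<ᵇ-suc k n)

  V-closedForm : ∀ n s → s ≤ d → V (suc n) s ≡ ∑[ k < suc d ] (((d ∸ s) C k) * t ^ k * Vshift n k)
  V-closedForm zero    s s≤d =
    trans (V-one s s≤d)
          (sym (trans (cong (V 0 0 + 0 +_) (Σ<-zero d (λ k _ → *-zeroʳ (((d ∸ s) C suc k) * t ^ suc k))))
                      (trans (+-identityʳ _) (+-identityʳ _))))
  V-closedForm (suc n) s s≤d = begin
      V (2 + n) s
    ≡⟨ V-step n s s≤d ⟩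
      V (1 + n) 0 + t * ∑[ r < d ] (if s ≤ᵇ r then V (1 + n) (suc r) else 0)
    ≡⟨ cong (λ z → V (1 + n) 0 + t * z) (Σ<-cong d (λ r r<d →
         cong (λ v → if s ≤ᵇ r then v else 0) (V-closedForm n (suc r) r<d))) ⟩
      V (1 + n) 0 + t * ∑[ r < d ] (if s ≤ᵇ r then ∑[ k < suc d ] (((d ∸ suc r) C k) * t ^ k * Vshift n k) else 0)
    ≡⟨ cong (λ z → V (1 + n) 0 + t * z) hockeyStick ⟩
      V (1 + n) 0 + t * ∑[ k < suc d ] (((d ∸ s) C suc k) * (t ^ k * Vshift n k))
    ≡⟨ cong (λ z → V (1 + n) 0 + t * z) (trans (Σ<-suc d term) (trans (cong (Σ< d term +_) lastTerm) (+-identityʳ _))) ⟩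
      V (1 + n) 0 + t * ∑[ k < d ] (((d ∸ s) C suc k) * (t ^ k * Vshift n k))
    ≡⟨ cong (V (1 + n) 0 +_) (trans (sym (Σ<-*ˡ d t _)) (Σ<-cong d (λ k _ → absorb-t k))) ⟩
      V (1 + n) 0 + ∑[ k < d ] (((d ∸ s) C suc k) * t ^ suc k * Vshift (suc n) (suc k))
    ≡⟨ cong (_+ ∑[ k < d ] (((d ∸ s) C suc k) * t ^ suc k * Vshift (suc n) (suc k)))
            (sym (+-identityʳ (V (1 + n) 0))) ⟩
      ∑[ k < suc d ] (((d ∸ s) C k) * t ^ k * Vshift (suc n) k)
    ∎
    where
    open ≡-Reasoning
    term : ℕ → ℕ
    term k = ((d ∸ s) C suc k) * (t ^ k * Vshift n k)
    hockeyStick : ∑[ r < d ] (if s ≤ᵇ r then ∑[ k < suc d ] (((d ∸ suc r) C k) * t ^ k * Vshift n k) else 0)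
                ≡ ∑[ k < suc d ] (((d ∸ s) C suc k) * (t ^ k * Vshift n k))
    hockeyStick = begin
        ∑[ r < d ] (if s ≤ᵇ r then ∑[ k < suc d ] (((d ∸ suc r) C k) * t ^ k * Vshift n k) else 0)
      ≡⟨ Σ<-cong d (λ r _ → trans (cong (λ v → if s ≤ᵇ r then v else 0)
                                        (Σ<-cong (suc d) (λ k _ → *-assoc ((d ∸ suc r) C k) (t ^ k) (Vshift n k))))
                                  (if-then-Σ< (s ≤ᵇ r) (suc d) (λ k → (d ∸ suc r) C k) (λ k → t ^ k * Vshift n k))) ⟩
        ∑[ r < d ] ∑[ k < suc d ] ((if s ≤ᵇ r then (d ∸ suc r) C k else 0) * (t ^ k * Vshift n k))
      ≡⟨ Σ<-swap d (suc d) (λ r k → (if s ≤ᵇ r then (d ∸ suc r) C k else 0) * (t ^ k * Vshift n k)) ⟩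
        ∑[ k < suc d ] ∑[ r < d ] ((if s ≤ᵇ r then (d ∸ suc r) C k else 0) * (t ^ k * Vshift n k))
      ≡⟨ Σ<-cong (suc d) (λ k _ →
           trans (Σ<-*ʳ d _ _) (cong (_* (t ^ k * Vshift n k)) (Σ<-hockeyStick d s k s≤d))) ⟩
        ∑[ k < suc d ] (((d ∸ s) C suc k) * (t ^ k * Vshift n k))
      ∎
    lastTerm : ((d ∸ s) C suc d) * (t ^ d * Vshift n d) ≡ 0
    lastTerm = cong (_* (t ^ d * Vshift n d)) (k>n⇒nCk≡0 (s≤s (m∸n≤m d s)))
    absorb-t : ∀ k → t * (((d ∸ s) C suc k) * (t ^ k * Vshift n k))
                     ≡ ((d ∸ s) C suc k) * t ^ suc k * Vshift (suc n) (suc k)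
    absorb-t k =
      trans (solve 4 (λ t c tk v → t :* (c :* (tk :* v)) := c :* (t :* tk) :* v) refl
                   t ((d ∸ s) C suc k) (t ^ k) (Vshift n k))
            (cong (((d ∸ s) C suc k) * t ^ suc k *_) (sym (Vshift-suc n k)))
      where open +-*-Solver

module Strip (h' t d : ℕ) (d≤h : d ≤ suc h') where

  open Tiling (suc h')
  open Weighted t

  R : ℕ
  R = h' + d

  V : ℕ → ℕ → ℕ
  V n s = weightedCount R n (protrusion s)

  R<2h : R < suc h' + suc h'
  R<2h = s≤s (+-monoʳ-≤ h' d≤h)

  bigFits-inside : ∀ r → r < d → (r + suc h' ≤ᵇ R) ≡ true
  bigFits-inside r r<d = ≤⇒≤ᵇ≡true (begin
    r + suc h' ≡⟨ +-suc r h' ⟩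
    suc r + h' ≤⟨ +-monoˡ-≤ h' r<d ⟩
    d + h'     ≡⟨ +-comm d h' ⟩
    h' + d     ∎)
    where open ≤-Reasoning

  bigFits-outside : ∀ i → (d + i + suc h' ≤ᵇ R) ≡ false
  bigFits-outside i = >⇒≤ᵇ≡false (begin-strict
    h' + d           ≡⟨ +-comm h' d ⟩
    d + h'           ≤⟨ +-monoˡ-≤ h' (m≤m+n d i) ⟩
    d + i + h'       <⟨ n<1+n _ ⟩
    suc (d + i + h') ≡⟨ +-suc (d + i) h' ⟨
    d + i + suc h'   ∎)
    where open ≤-Reasoning

  -- A copy of L_h needs two columns.
  V-one : ∀ s → s ≤ d → V 1 s ≡ V 0 0
  V-one s s≤d = trans (Transfer.weightedCount-transfer h' t 0 R s R<2h (≤-trans s≤d d≤h))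
    (trans (cong (V 0 0 +_) (Σ<-zero R (λ r _ →
              cong (λ b → if b ∧ (s ≤ᵇ r) then t * V 0 (suc r) else 0) (∧-zeroʳ (r + suc h' ≤ᵇ R)))))
           (+-identityʳ _))

  V-step : ∀ n s → s ≤ d →
           V (2 + n) s ≡ V (1 + n) 0 + t * ∑[ r < d ] (if s ≤ᵇ r then V (1 + n) (suc r) else 0)
  V-step n s s≤d = trans (Transfer.weightedCount-transfer h' t (suc n) R s R<2h (≤-trans s≤d d≤h))
    (cong (V (1 + n) 0 +_) (begin
      ∑[ r < R ] (if bigFits R r ∧ (s ≤ᵇ r) then t * V (1 + n) (suc r) else 0)
    ≡⟨ Σ<-truncate _ (m≤n+m d h') (λ i →
         cong (λ b → if (b ∧ true) ∧ (s ≤ᵇ d + i) then t * V (1 + n) (suc (d + i)) else 0) (bigFits-outside i)) ⟩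
      ∑[ r < d ] (if bigFits R r ∧ (s ≤ᵇ r) then t * V (1 + n) (suc r) else 0)
    ≡⟨ Σ<-cong d (λ r r<d → trans
         (cong (λ b → if (b ∧ true) ∧ (s ≤ᵇ r) then t * V (1 + n) (suc r) else 0) (bigFits-inside r r<d))
         (if-then-*ˡ (s ≤ᵇ r) t (V (1 + n) (suc r)))) ⟩
      ∑[ r < d ] (t * (if s ≤ᵇ r then V (1 + n) (suc r) else 0))
    ≡⟨ Σ<-*ˡ d t _ ⟩
      t * ∑[ r < d ] (if s ≤ᵇ r then V (1 + n) (suc r) else 0)
    ∎))
    where
    open ≡-Reasoning
    open FirstColumn h' (suc n) using (bigFits)

  P-empty : P (suc h') d 0 t ≡ 1
  P-empty = weightedCount-zero R (λ _ _ → 0)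

  P≡V : ∀ m → P (suc h') d m t ≡ V m 0
  P≡V m = weightedCount-cong R m {λ _ _ → 0} {protrusion 0} λ { x zero → refl ; x (suc y) → refl }

  open TransferRecurrence t d V V-one V-step public

  Vshift≡Pshift : ∀ n k → Vshift n k ≡ Pshift (suc h') d n k t
  Vshift≡Pshift n k = cong (λ v → if k ≤ᵇ n then v else 0) (sym (P≡V (n ∸ k)))

theorem2p5 : (h d : ℕ) → 1 ≤ h → 1 ≤ d → d ≤ h →
    ((t : ℕ) → P h d 0 t ≡ 1)
    × ((n t : ℕ) → P h d (suc n) t ≡ recRHS h d n t)
theorem2p5 (suc h') d _ _ d≤h = (λ t → Strip.P-empty h' t d d≤h) , recurrence
  where
  recurrence : (n t : ℕ) → P (suc h') d (suc n) t ≡ recRHS (suc h') d n t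
  recurrence n t = begin
      P (suc h') d (suc n) t                                      ≡⟨ P≡V (suc n) ⟩
      V (suc n) 0                                                 ≡⟨ V-closedForm n 0 z≤n ⟩
      ∑[ k < suc d ] ((d C k) * t ^ k * Vshift n k)               ≡⟨ Σ<-cong (suc d) (λ k _ →
                                                                       cong ((d C k) * t ^ k *_) (Vshift≡Pshift n k)) ⟩
      ∑[ k < suc d ] ((d C k) * t ^ k * Pshift (suc h') d n k t)  ≡⟨ sum-applyUpTo (suc d) id _ ⟨
      recRHS (suc h') d n t                                       ∎
    where
    open ≡-Reasoning
    open Strip h' t d d≤h
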